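{- Let $\Gamma$ be an equality language and let $\Psi=\exists y_1\forall x_1\exists y_2\forall x_2\dots\exists y_n\forall x_n\,\Phi$ be a sentence where $\Phi$ is a conjunction of atoms over $\Gamma$. If $\Psi$ is true in $\Gamma$, then $\zeta(\Psi)$ is true in $\Gamma$.
   Context: An equality language is a finite set of relations over $\mathbb{N}$ each first-order definable in $(\mathbb{N};=)$. Let $[2n]=\{1,\dots,2n\}$. For each tuple $(a_1,\dots,a_n)\in[2n]^n$, the formula $\Phi_{a_1,\dots,a_n}$ is obtained from $\Phi$ by replacing each $y_i$ by a new variable $y_i^{a_1,\dots,a_{i-1}}$ (for $i=1$, $y_1$ is kept) and each $x_i$ by a new variable $x_i^{a_1,\dots,a_i}$. The sentence $\zeta(\Psi)$ has quantifier-free part $\bigwedge_{(a_1,\dots,a_n)\in[2n]^n}\Phi_{a_1,\dots,a_n}$, in which all the $x$-variables are universally quantified first (outermost) and then all the $y$-variables are existentially quantified. -}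

module Defs where

open import Data.Nat using (ℕ; zero; suc; _*_)
open import Data.Fin using (Fin; zero; suc; toℕ)
open import Data.Vec using (Vec; []; _∷_; lookup)
open import Data.List using (List; length) renaming (lookup to lookupL)
open import Data.List.Relation.Unary.All using (All)
open import Data.Product using (Σ; _×_; _,_; proj₁; proj₂)
open import Data.Sum using (_⊎_; inj₁; inj₂)
open import Data.Empty using (⊥)
open import Relation.Binary.PropositionalEquality using (_≡_)

data Fm (k : ℕ) : Set where
  eq  : Fin k → Fin k → Fm k
  neg : Fm k → Fm k
  and : Fm k → Fm k → Fm k
  ex  : Fm (suc k) → Fm k

cons : {k : ℕ} → ℕ → (Fin k → ℕ) → Fin (suc k) → ℕ
cons v ρ zero    = v
cons v ρ (suc i) = ρ i

Sat : {k : ℕ} → Fm k → (Fin k → ℕ) → Set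
Sat (eq i j)  ρ = ρ i ≡ ρ j
Sat (neg φ)   ρ = Sat φ ρ → ⊥
Sat (and φ ψ) ρ = Sat φ ρ × Sat ψ ρ
Sat (ex φ)    ρ = Σ ℕ λ v → Sat φ (cons v ρ)

-- A relation over ℕ first-order definable in (ℕ; =): given by its arity
-- and a defining formula; the relation is {t | Sat φ t}.

FODefRel : Set
FODefRel = Σ ℕ Fm

arity : FODefRel → ℕ
arity = proj₁

InRel : (R : FODefRel) → (Fin (arity R) → ℕ) → Set
InRel R t = Sat (proj₂ R) t

EqLang : Set
EqLang = List FODefRel

-- Atoms over Γ in the variables y₁..yₙ (inj₁ i ↦ y_{i+1})
-- and x₁..xₙ (inj₂ i ↦ x_{i+1}).

Var : ℕ → Set
Var n = Fin n ⊎ Fin n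

Atom : EqLang → ℕ → Set
Atom Γ n = Σ (Fin (length Γ)) λ r → (Fin (arity (lookupL Γ r)) → Var n)

Conj : EqLang → ℕ → Set
Conj Γ n = List (Atom Γ n)

valVar : {n : ℕ} → (Fin n → ℕ) → (Fin n → ℕ) → Var n → ℕ
valVar ys xs (inj₁ i) = ys i
valVar ys xs (inj₂ i) = xs i

HoldsAtom : {Γ : EqLang} {n : ℕ} → (Fin n → ℕ) → (Fin n → ℕ) → Atom Γ n → Set
HoldsAtom {Γ} ys xs (r , args) = InRel (lookupL Γ r) (λ j → valVar ys xs (args j))

Holds : (Γ : EqLang) {n : ℕ} → Conj Γ n → (Fin n → ℕ) → (Fin n → ℕ) → Set
Holds Γ Φ ys xs = All (HoldsAtom {Γ} ys xs) Φ

Prefix : (n : ℕ) → (Vec ℕ n → Vec ℕ n → Set) → Set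
Prefix zero    P = P [] []
Prefix (suc n) P = Σ ℕ λ y → (x : ℕ) → Prefix n (λ ys xs → P (y ∷ ys) (x ∷ xs))

PsiTrue : (Γ : EqLang) (n : ℕ) → Conj Γ n → Set
PsiTrue Γ n Φ = Prefix n (λ ys xs → Holds Γ Φ (lookup ys) (lookup xs))

-- For a ∈ [2n]ⁿ (as Vec (Fin (2n)) n) and i : Fin n (0-based,
-- standing for index i+1):
--   yPre a i = (a₁,…,a_{i})     (superscript of y_{i+1})
--   xPre a i = (a₁,…,a_{i+1})   (superscript of x_{i+1})

yPre : {A : Set} {n : ℕ} → Vec A n → (i : Fin n) → Vec A (toℕ i)
yPre (a ∷ as) zero    = []
yPre (a ∷ as) (suc i) = a ∷ yPre as i

xPre : {A : Set} {n : ℕ} → Vec A n → (i : Fin n) → Vec A (suc (toℕ i))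
xPre (a ∷ as) zero    = a ∷ []
xPre (a ∷ as) (suc i) = a ∷ xPre as i

-- Assignments to the variables of ζ(Ψ): X i w is the value of x_{i+1}^w,
-- Y i w the value of y_{i+1}^w.
XAssign : ℕ → Set
XAssign n = (i : Fin n) → Vec (Fin (2 * n)) (suc (toℕ i)) → ℕ

YAssign : ℕ → Set
YAssign n = (i : Fin n) → Vec (Fin (2 * n)) (toℕ i) → ℕ

ZetaTrue : (Γ : EqLang) (n : ℕ) → Conj Γ n → Set
ZetaTrue Γ n Φ =
  (X : XAssign n) → Σ (YAssign n) λ Y →
    (a : Vec (Fin (2 * n)) n) →
      Holds Γ Φ (λ i → Y i (yPre a i)) (λ i → X i (xPre a i))

module Submission where

-- In ζ(Ψ) the variables x_i^{a₁…aᵢ} and y_i^{a₁…a_{i-1}} are the nodes of a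
-- tree of branching [2n], and each branch a carries its own copy Φ_a of Φ.
-- Given values for all x-variables, play a winning strategy of the
-- ∃-player of Ψ along every branch simultaneously: the answer y_i depends
-- only on x₁,…,x_{i-1}, i.e. only on the node a₁…a_{i-1}, so it is a
-- well-defined value of y_i^{a₁…a_{i-1}}, and every Φ_a holds because its
-- branch is a play won by that strategy.  The branching factor is irrelevant.

open import Defs
open import Data.Nat using (ℕ; zero; suc)
open import Data.Fin using (Fin; zero; suc; toℕ)
open import Data.Vec using (Vec; []; _∷_; lookup; tabulate)
open import Data.Vec.Properties using (lookup∘tabulate)
open import Data.List using () renaming (lookup to lookupL)
import Data.List.Relation.Unary.All as All
open import Data.Product using (Σ; _,_; proj₁; proj₂)
open import Data.Sum using (inj₁; inj₂)
open import Relation.Binary.PropositionalEquality using (_≗_; refl; sym; trans)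

cons-cong : {k : ℕ} (v : ℕ) {ρ σ : Fin k → ℕ} → ρ ≗ σ → cons v ρ ≗ cons v σ
cons-cong v ρ≗σ zero    = refl
cons-cong v ρ≗σ (suc i) = ρ≗σ i

Sat-resp : {k : ℕ} (φ : Fm k) {ρ σ : Fin k → ℕ} → ρ ≗ σ → Sat φ ρ → Sat φ σ
Sat-resp (eq i j)  ρ≗σ ρi≡ρj     = trans (sym (ρ≗σ i)) (trans ρi≡ρj (ρ≗σ j))
Sat-resp (neg φ)   ρ≗σ ¬φρ φσ    = ¬φρ (Sat-resp φ (λ i → sym (ρ≗σ i)) φσ)
Sat-resp (and φ ψ) ρ≗σ (φρ , ψρ) = Sat-resp φ ρ≗σ φρ , Sat-resp ψ ρ≗σ ψρ
Sat-resp (ex φ)    ρ≗σ (v , φvρ) = v , Sat-resp φ (cons-cong v ρ≗σ) φvρ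

valVar-cong : {n : ℕ} {ys ys′ xs xs′ : Fin n → ℕ} →
  ys ≗ ys′ → xs ≗ xs′ → valVar ys xs ≗ valVar ys′ xs′
valVar-cong ys≗ys′ xs≗xs′ (inj₁ i) = ys≗ys′ i
valVar-cong ys≗ys′ xs≗xs′ (inj₂ i) = xs≗xs′ i

Holds-resp : (Γ : EqLang) {n : ℕ} (Φ : Conj Γ n) {ys ys′ xs xs′ : Fin n → ℕ} →
  ys ≗ ys′ → xs ≗ xs′ → Holds Γ Φ ys xs → Holds Γ Φ ys′ xs′
Holds-resp Γ Φ ys≗ys′ xs≗xs′ = All.map λ { {r , args} →
  Sat-resp (proj₂ (lookupL Γ r)) (λ j → valVar-cong ys≗ys′ xs≗xs′ (args j)) }

-- Node w of depth i+1 of the B-branching tree holds the x-value X i w; the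
-- y-values Y i w sit at nodes of depth i, and every branch a is a play
-- satisfying P.
BranchwiseWinning : (B : Set) (n : ℕ) (P : Vec ℕ n → Vec ℕ n → Set) →
  ((i : Fin n) → Vec B (suc (toℕ i)) → ℕ) → Set
BranchwiseWinning B n P X =
  Σ ((i : Fin n) → Vec B (toℕ i) → ℕ) λ Y →
    (a : Vec B n) → P (tabulate λ i → Y i (yPre a i)) (tabulate λ i → X i (xPre a i))

Prefix⇒BranchwiseWinning : {B : Set} (n : ℕ) (P : Vec ℕ n → Vec ℕ n → Set) →
  Prefix n P → (X : (i : Fin n) → Vec B (suc (toℕ i)) → ℕ) → BranchwiseWinning B n P X
Prefix⇒BranchwiseWinning zero    P winning X = (λ ()) , λ { [] → winning }
Prefix⇒BranchwiseWinning {B} (suc n) P (y , respond) X = Y , wins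
  where
  P-after : B → Vec ℕ n → Vec ℕ n → Set
  P-after b ys xs = P (y ∷ ys) (X zero (b ∷ []) ∷ xs)

  X-below : B → (i : Fin n) → Vec B (suc (toℕ i)) → ℕ
  X-below b i w = X (suc i) (b ∷ w)

  subtree : (b : B) → BranchwiseWinning B n (P-after b) (X-below b)
  subtree b = Prefix⇒BranchwiseWinning n (P-after b) (respond (X zero (b ∷ []))) (X-below b)

  Y : (i : Fin (suc n)) → Vec B (toℕ i) → ℕ
  Y zero    []      = y
  Y (suc i) (b ∷ w) = proj₁ (subtree b) i w

  wins : (a : Vec B (suc n)) →
    P (tabulate λ i → Y i (yPre a i)) (tabulate λ i → X i (xPre a i))
  wins (b ∷ a) = proj₂ (subtree b) a

mainTheorem6 : (Γ : EqLang) (n : ℕ) (Φ : Conj Γ n) →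
    PsiTrue Γ n Φ → ZetaTrue Γ n Φ
mainTheorem6 Γ n Φ ψ X =
  Y , λ a → Holds-resp Γ Φ (lookup∘tabulate _) (lookup∘tabulate _) (wins a)
  where
  open Σ (Prefix⇒BranchwiseWinning n (λ ys xs → Holds Γ Φ (lookup ys) (lookup xs)) ψ X)
    renaming (proj₁ to Y; proj₂ to wins)
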